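{- Let $G$ be a $d$-degenerate graph with $n$ vertices such that $\Delta(G)<\frac{\sqrt{n}-2d-1}{2}$. Then $O\chi(G)=\lceil\sqrt{n}\,\rceil$.
   Context: A graph is $d$-degenerate if there is an ordering of its vertices in which each vertex has at most $d$ neighbours occurring earlier in the ordering. $\Delta(G)$ denotes the maximum degree. Two proper vertex colourings $c_1,c_2$ of a graph are orthogonal if whenever two distinct vertices receive the same colour in one colouring, they receive different colours in the other (equivalently, $v\mapsto (c_1(v),c_2(v))$ is injective). The orthogonal chromatic number $O\chi(G)$ is the minimum number $c$ such that $G$ has a pair of orthogonal proper vertex colourings each using at most $c$ colours. -}

module Defs where

open import Data.Bool using (Bool; true; false; _∧_; T)
open import Data.Nat using (ℕ; _≤_; _<_; _⊔_; _*_; _∸_; _+_)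
open import Data.Nat.Base using (_<ᵇ_)
open import Data.Fin using (Fin; toℕ)
open import Data.List using (List; length; filterᵇ; allFin; map; foldr)
open import Data.Product using (Σ; _×_; _,_; ∃)
open import Function.Definitions using (Injective)
open import Relation.Binary.PropositionalEquality using (_≡_)
open import Relation.Nullary using (¬_)

record Graph (n : ℕ) : Set where
  field
    adj    : Fin n → Fin n → Bool
    sym    : ∀ u v → adj u v ≡ adj v u
    irrefl : ∀ v → adj v v ≡ false
open Graph public

deg : ∀ {n} → Graph n → Fin n → ℕ
deg {n} G v = length (filterᵇ (adj G v) (allFin n))

maxDeg : ∀ {n} → Graph n → ℕ
maxDeg {n} G = foldr _⊔_ 0 (map (deg G) (allFin n))

earlierNbrs : ∀ {n} → Graph n → (Fin n → Fin n) → Fin n → ℕ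
earlierNbrs {n} G pos v =
  length (filterᵇ (λ u → adj G v u ∧ (toℕ (pos u) <ᵇ toℕ (pos v))) (allFin n))

-- d-degenerate: there is an ordering of the vertices (an injective
-- position map Fin n → Fin n, i.e. a permutation) in which every vertex
-- has at most d neighbours earlier in the ordering.
Degenerate : ∀ {n} → ℕ → Graph n → Set
Degenerate {n} d G =
  Σ (Fin n → Fin n) λ pos → Injective _≡_ _≡_ pos × (∀ v → earlierNbrs G pos v ≤ d)

Proper : ∀ {n c} → Graph n → (Fin n → Fin c) → Set
Proper G col = ∀ u v → T (adj G u v) → ¬ (col u ≡ col v)

Orthogonal : ∀ {n c} → (Fin n → Fin c) → (Fin n → Fin c) → Set
Orthogonal c₁ c₂ = ∀ u v → c₁ u ≡ c₁ v → c₂ u ≡ c₂ v → u ≡ v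

HasOrthPair : ∀ {n} → Graph n → ℕ → Set
HasOrthPair {n} G c =
  Σ (Fin n → Fin c) λ c₁ → Σ (Fin n → Fin c) λ c₂ →
    Proper G c₁ × Proper G c₂ × Orthogonal c₁ c₂

OChiIs : ∀ {n} → Graph n → ℕ → Set
OChiIs G k = HasOrthPair G k × (∀ c → HasOrthPair G c → k ≤ c)

IsCeilSqrt : ℕ → ℕ → Set
IsCeilSqrt n k = n ≤ k * k × (∀ j → n ≤ j * j → k ≤ j)

-- Δ(G) < (√n - 2d - 1)/2, rewritten without reals:
-- 2Δ + 2d + 1 < √n  ⇔  (2Δ + 2d + 1)² < n   (both sides nonnegative)
DegreeBound : ∀ {n} → Graph n → ℕ → Set
DegreeBound {n} G d = (2 * maxDeg G + 2 * d + 1) * (2 * maxDeg G + 2 * d + 1) < n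

module Submission where

-- A pair of orthogonal colourings with c colours each is the same thing as
-- an injective placement of the vertices into the cells of a c × c grid (row =
-- first colour, column = second colour) in which adjacent vertices share
-- neither a row nor a column.  Since there are only c² cells, n ≤ c², which
-- gives the lower bound Oχ(G) ≥ ⌈√n⌉ for every graph.
--
-- For the upper bound we place the vertices into the k × k grid, k = ⌈√n⌉,
-- one by one along a degeneracy order.  When v arrives, its at most d earlier
-- neighbours block at most d rows and d columns; the remaining "good" cells
-- number at least (k − d)².  Pick a free cell fr (one exists, as fewer than
-- n ≤ k² vertices are placed).  The occupants of the 2k cells in the row and
-- column of fr have at most 2kΔ neighbours in total ("blocked" vertices), and
-- 2kΔ < (k − d)² by the degree bound, so some good cell g is not occupied by
-- a blocked vertex.  If g is free, v goes there; otherwise its occupant w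
-- moves to fr and v takes g.

open import Defs hiding (sym)
open import Data.Bool using (T; _∧_)
open import Data.Bool.Properties using (T?; T-∧)
open import Data.Empty using (⊥-elim)
open import Data.Fin using (Fin; zero; suc; toℕ; fromℕ<)
import Data.Fin.Properties as Finₚ
open import Data.List using (List; []; _∷_; length; lookup; map; filter; filterᵇ; _++_; allFin; cartesianProduct; concatMap; foldr)
open import Data.List.Properties using (length-map; length-++; length-tabulate; filter-notAll)
open import Data.List.Membership.Propositional using (_∈_; _∉_; find; lose)
open import Data.List.Membership.Propositional.Properties using (∈-lookup; ∈-allFin; ∈-map⁺; ∈-filter⁺; ∈-filter⁻; ∈-cartesianProduct⁻; ∈-++⁺ˡ; ∈-++⁺ʳ; ∈-concat⁺′)
open import Data.List.Membership.Setoid.Properties using (index-injective)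
open import Data.List.Relation.Binary.Subset.Propositional using (_⊆_)
open import Data.List.Relation.Unary.All as All using ()
open import Data.List.Relation.Unary.Any using (here; there; any?)
open import Data.List.Relation.Unary.AllPairs using (_∷_)
open import Data.List.Relation.Unary.Unique.Propositional using (Unique)
open import Data.List.Relation.Unary.Unique.Propositional.Properties using (allFin⁺; filter⁺; cartesianProduct⁺)
open import Data.Nat using (ℕ; zero; suc; _+_; _*_; _∸_; _⊔_; _≤_; _<_; _<?_; _<ᵇ_; z≤n)
open import Data.Nat.Properties
open import Data.Nat.Tactic.RingSolver using (solve-∀)
open import Data.Product using (∃; _×_; _,_; proj₁; proj₂)
open import Data.Product.Properties using (≡-dec)
open import Data.Sum using (inj₁; inj₂)
open import Function using (_∘_)
open import Function.Bundles using (Equivalence)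
open import Function.Definitions using (Injective)
open import Level using (0ℓ)
open import Relation.Binary.Definitions using (DecidableEquality)
open import Relation.Binary.PropositionalEquality
open import Relation.Nullary using (¬_; Dec; yes; no; ¬?)
open import Relation.Nullary.Decidable using (_×-dec_; decidable-stable)
open import Relation.Unary using (Pred; Decidable; U; _∪_; ｛_｝)

module _ {A : Set} where

  lookup-injective : ∀ {xs : List A} → Unique xs → ∀ {i j} → lookup xs i ≡ lookup xs j → i ≡ j
  lookup-injective (_ ∷ _)      {zero}  {zero}  _ = refl
  lookup-injective (x≢ ∷ _)     {zero}  {suc j} e = ⊥-elim (All.lookup x≢ (∈-lookup j) e)
  lookup-injective (x≢ ∷ _)     {suc i} {zero}  e = ⊥-elim (All.lookup x≢ (∈-lookup i) (sym e))
  lookup-injective (_ ∷ unique) {suc i} {suc j} e = cong suc (lookup-injective unique e)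

  unique⊆⇒length≤ : ∀ {xs ys : List A} → Unique xs → xs ⊆ ys → length xs ≤ length ys
  unique⊆⇒length≤ unique xs⊆ys = Finₚ.injective⇒≤ λ {i} {j} same →
    lookup-injective unique (index-injective (setoid A) (xs⊆ys (∈-lookup i)) (xs⊆ys (∈-lookup j)) same)

  module _ (_≟_ : DecidableEquality A) where
    open import Data.List.Membership.DecPropositional _≟_ using (_∈?_)

    longer⇒∃∉ : ∀ {xs ys : List A} → Unique xs → length ys < length xs → ∃ λ x → x ∈ xs × x ∉ ys
    longer⇒∃∉ {xs} {ys} unique shorter with any? (λ x → ¬? (x ∈? ys)) xs
    ... | yes outsider = find outsider
    ... | no none = ⊥-elim (<⇒≱ shorter (unique⊆⇒length≤ unique inside))
      where
      inside : xs ⊆ ys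
      inside {x} x∈xs = decidable-stable (x ∈? ys) (λ x∉ys → none (lose x∈xs x∉ys))

  length-concatMap≤ : ∀ {B : Set} (g : A → List B) {b} → (∀ x → length (g x) ≤ b) →
                      ∀ xs → length (concatMap g xs) ≤ length xs * b
  length-concatMap≤ g short [] = z≤n
  length-concatMap≤ g {b} short (x ∷ xs) = begin
    length (g x ++ concatMap g xs)         ≡⟨ length-++ (g x) ⟩
    length (g x) + length (concatMap g xs) ≤⟨ +-mono-≤ (short x) (length-concatMap≤ g short xs) ⟩
    b + length xs * b                      ∎
    where open ≤-Reasoning

  length-cartesianProduct : ∀ {B : Set} (xs : List A) (ys : List B) →
                            length (cartesianProduct xs ys) ≡ length xs * length ys
  length-cartesianProduct [] ys = refl
  length-cartesianProduct (x ∷ xs) ys = begin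
    length (map (x ,_) ys ++ cartesianProduct xs ys)         ≡⟨ length-++ (map (x ,_) ys) ⟩
    length (map (x ,_) ys) + length (cartesianProduct xs ys)
      ≡⟨ cong₂ _+_ (length-map (x ,_) ys) (length-cartesianProduct xs ys) ⟩
    length ys + length xs * length ys                        ∎
    where open ≡-Reasoning

≤-foldr-⊔ : ∀ {m ms} → m ∈ ms → m ≤ foldr _⊔_ 0 ms
≤-foldr-⊔ {ms = m ∷ _} (here refl) = m≤m⊔n m _
≤-foldr-⊔ {ms = m ∷ _} (there m∈) = ≤-trans (≤-foldr-⊔ m∈) (m≤n⊔m m _)

length-allFin : ∀ k → length (allFin k) ≡ k
length-allFin k = length-tabulate (λ i → i)

module _ {k : ℕ} where
  open import Data.List.Membership.DecPropositional (Finₚ._≟_ {k}) using (_∈?_)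

  outside : List (Fin k) → List (Fin k)
  outside xs = filter (λ a → ¬? (a ∈? xs)) (allFin k)

  ∈-outside⁻ : ∀ {a xs} → a ∈ outside xs → a ∉ xs
  ∈-outside⁻ {xs = xs} a∈ = proj₂ (∈-filter⁻ (λ a → ¬? (a ∈? xs)) {xs = allFin k} a∈)

  outside-unique : ∀ xs → Unique (outside xs)
  outside-unique xs = filter⁺ (λ a → ¬? (a ∈? xs)) (allFin⁺ k)

  outside-length : ∀ xs → k ∸ length xs ≤ length (outside xs)
  outside-length xs = m≤n+o⇒m∸n≤o k (length xs) (begin
    k                               ≡⟨ length-allFin k ⟨
    length (allFin k)               ≤⟨ unique⊆⇒length≤ (allFin⁺ k) covered ⟩
    length (xs ++ outside xs)       ≡⟨ length-++ xs ⟩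
    length xs + length (outside xs) ∎)
    where
    open ≤-Reasoning
    covered : allFin k ⊆ xs ++ outside xs
    covered {a} _ with a ∈? xs
    ... | yes a∈ = ∈-++⁺ˡ a∈
    ... | no a∉ = ∈-++⁺ʳ xs (∈-filter⁺ (λ a → ¬? (a ∈? xs)) (∈-allFin a) a∉)

square-<-bound : ∀ {m n k} → m * m < n → n ≤ k * k → m < k
square-<-bound m²<n n≤k² = ≰⇒> λ k≤m → <⇒≱ (<-≤-trans m²<n n≤k²) (*-mono-≤ k≤m k≤m)

-- Writing e for k − d: if e ≥ a = 2Δ + d + 2 then 2kΔ < e², because
-- e² ≥ ea = 2eΔ + e(d + 2) ≥ 2eΔ + a(d + 2) > 2eΔ + 2dΔ = 2kΔ.
cross-bound : ∀ e d Δ → 2 * Δ + d + 2 ≤ e → (e + d + (e + d)) * Δ < e * e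
cross-bound e d Δ a≤e = begin-strict
  (e + d + (e + d)) * Δ     ≡⟨ expand e d Δ ⟩
  e * (2 * Δ) + 2 * d * Δ   <⟨ +-monoʳ-< (e * (2 * Δ)) 2dΔ<a[d+2] ⟩
  e * (2 * Δ) + a * (d + 2) ≤⟨ +-monoʳ-≤ (e * (2 * Δ)) (*-monoˡ-≤ (d + 2) a≤e) ⟩
  e * (2 * Δ) + e * (d + 2) ≡⟨ factor e d Δ ⟩
  e * a                     ≤⟨ *-monoʳ-≤ e a≤e ⟩
  e * e                     ∎
  where
  open ≤-Reasoning
  a = 2 * Δ + d + 2
  expand : ∀ e d Δ → (e + d + (e + d)) * Δ ≡ e * (2 * Δ) + 2 * d * Δ
  expand = solve-∀
  factor : ∀ e d Δ → e * (2 * Δ) + e * (d + 2) ≡ e * (2 * Δ + d + 2)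
  factor = solve-∀
  surplus : ∀ d Δ → (2 * Δ + d + 2) * (d + 2) ≡ suc (2 * d * Δ) + (4 * Δ + d * d + 4 * d + 3)
  surplus = solve-∀
  2dΔ<a[d+2] : 2 * d * Δ < a * (d + 2)
  2dΔ<a[d+2] = ≤-trans (m≤m+n _ _) (≤-reflexive (sym (surplus d Δ)))

-- The numerical heart of the theorem: if 2Δ + 2d + 1 < k then the occupants
-- of the 2k cells of one row and one column of the k × k grid have fewer
-- than (k − d)² neighbours.
degree-bound⇒sparse : ∀ k d Δ → 2 * Δ + 2 * d + 1 < k → (k + k) * Δ < (k ∸ d) * (k ∸ d)
degree-bound⇒sparse k d Δ bound = subst (λ m → (m + m) * Δ < e * e) e+d≡k (cross-bound e d Δ a≤e)
  where
  e = k ∸ d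
  regroup : ∀ d Δ → suc (2 * Δ + 2 * d + 1) ≡ (2 * Δ + d + 2) + d
  regroup = solve-∀
  a+d≤k : (2 * Δ + d + 2) + d ≤ k
  a+d≤k = subst (_≤ k) (regroup d Δ) bound
  a≤e : 2 * Δ + d + 2 ≤ e
  a≤e = m+n≤o⇒m≤o∸n _ a+d≤k
  e+d≡k : e + d ≡ k
  e+d≡k = m∸n+n≡m (m+n≤o⇒n≤o (2 * Δ + d + 2) a+d≤k)

module _ {n : ℕ} (G : Graph n) where

  nbrs : Fin n → List (Fin n)
  nbrs u = filterᵇ (adj G u) (allFin n)

  ∈-nbrs : ∀ {u w} → T (adj G u w) → w ∈ nbrs u
  ∈-nbrs {u} {w} u~w = ∈-filter⁺ (T? ∘ adj G u) (∈-allFin w) u~w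

  nbrs-length : ∀ u → length (nbrs u) ≤ maxDeg G
  nbrs-length u = ≤-foldr-⊔ (∈-map⁺ (deg G) (∈-allFin u))

  adj-sym : ∀ {u w} → T (adj G u w) → T (adj G w u)
  adj-sym {u} {w} = subst T (Graph.sym G u w)

module Grid {n : ℕ} (G : Graph n) (k : ℕ) where

  -- A cell is a pair (row, column), i.e. a pair of colours.
  Cell : Set
  Cell = Fin k × Fin k

  _≟ᶜ_ : DecidableEquality Cell
  _≟ᶜ_ = ≡-dec Finₚ._≟_ Finₚ._≟_

  Separated : Cell → Cell → Set
  Separated p q = proj₁ p ≢ proj₁ q × proj₂ p ≢ proj₂ q

  separated-sym : ∀ {p q} → Separated p q → Separated q p
  separated-sym (different-row , different-col) = different-row ∘ sym , different-col ∘ sym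

  record Valid (P : Pred (Fin n) 0ℓ) (f : Fin n → Cell) : Set where
    field
      injective : ∀ {u w} → P u → P w → f u ≡ f w → u ≡ w
      separated : ∀ {u w} → P u → P w → T (adj G u w) → Separated (f u) (f w)
  open Valid public

  restrict : ∀ {P Q f} → (∀ {u} → Q u → P u) → Valid P f → Valid Q f
  restrict Q⊆P valid = record
    { injective = λ Qu Qw → injective valid (Q⊆P Qu) (Q⊆P Qw)
    ; separated = λ Qu Qw → separated valid (Q⊆P Qu) (Q⊆P Qw) }

  Free : Pred (Fin n) 0ℓ → (Fin n → Cell) → Cell → Set
  Free P f c = ∀ {u} → P u → f u ≢ c

  Compatible : Pred (Fin n) 0ℓ → (Fin n → Cell) → Fin n → Cell → Set
  Compatible P f v c = ∀ {u} → P u → T (adj G v u) → Separated c (f u)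

  _[_↦_] : (Fin n → Cell) → Fin n → Cell → Fin n → Cell
  (f [ v ↦ c ]) u with u Finₚ.≟ v
  ... | yes _ = c
  ... | no _ = f u

  ↦-self : ∀ f v c → (f [ v ↦ c ]) v ≡ c
  ↦-self f v c with v Finₚ.≟ v
  ... | yes _ = refl
  ... | no v≢v = ⊥-elim (v≢v refl)

  ↦-other : ∀ f {v} c {u} → u ≢ v → (f [ v ↦ c ]) u ≡ f u
  ↦-other f {v} c {u} u≢v with u Finₚ.≟ v
  ... | yes u≡v = ⊥-elim (u≢v u≡v)
  ... | no _ = refl

  data NewOrOld (P : Pred (Fin n) 0ℓ) (v : Fin n) : Fin n → Set where
    new : NewOrOld P v v
    old : ∀ {u} → P u → u ≢ v → NewOrOld P v u

  classify : ∀ {P v u} → (P ∪ ｛ v ｝) u → NewOrOld P v u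
  classify (inj₂ refl) = new
  classify {v = v} {u} (inj₁ Pu) with u Finₚ.≟ v
  ... | yes refl = new
  ... | no u≢v = old Pu u≢v

  place : ∀ {P f v c} → Valid P f → Free P f c → Compatible P f v c →
          Valid (P ∪ ｛ v ｝) (f [ v ↦ c ])
  place {P} {f} {v} {c} valid free compatible = record { injective = inj ; separated = sep }
    where
    f′ = f [ v ↦ c ]
    unmoved : ∀ {u} → u ≢ v → f′ u ≡ f u
    unmoved = ↦-other f c
    new≢old : ∀ {u} → P u → u ≢ v → f′ v ≢ f′ u
    new≢old Pu u≢v same = free Pu (trans (sym (unmoved u≢v)) (trans (sym same) (↦-self f v c)))
    new-sep : ∀ {u} → P u → u ≢ v → T (adj G v u) → Separated (f′ v) (f′ u)
    new-sep Pu u≢v v~u = subst₂ Separated (sym (↦-self f v c)) (sym (unmoved u≢v)) (compatible Pu v~u)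
    inj : ∀ {u w} → (P ∪ ｛ v ｝) u → (P ∪ ｛ v ｝) w → f′ u ≡ f′ w → u ≡ w
    inj u∈ w∈ same with classify {P} u∈ | classify {P} w∈
    ... | new        | new        = refl
    ... | new        | old Pw w≢v = ⊥-elim (new≢old Pw w≢v same)
    ... | old Pu u≢v | new        = ⊥-elim (new≢old Pu u≢v (sym same))
    ... | old Pu u≢v | old Pw w≢v =
      injective valid Pu Pw (trans (sym (unmoved u≢v)) (trans same (unmoved w≢v)))
    sep : ∀ {u w} → (P ∪ ｛ v ｝) u → (P ∪ ｛ v ｝) w → T (adj G u w) → Separated (f′ u) (f′ w)
    sep u∈ w∈ u~w with classify {P} u∈ | classify {P} w∈
    ... | new        | new        = ⊥-elim (subst T (irrefl G v) u~w)
    ... | new        | old Pw w≢v = new-sep Pw w≢v u~w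
    ... | old Pu u≢v | new        = separated-sym (new-sep Pu u≢v (adj-sym G u~w))
    ... | old Pu u≢v | old Pw w≢v =
      subst₂ Separated (sym (unmoved u≢v)) (sym (unmoved w≢v)) (separated valid Pu Pw u~w)

  -- If w ∈ P may move to the free cell fr, and the cell of w is compatible
  -- with v (in particular v is not adjacent to w), then moving w to fr and
  -- putting v where w was keeps the placement valid.
  relocate : ∀ {P f v w fr} → Valid P f → P w → Free P f fr → Compatible P f w fr →
             Compatible P f v (f w) → Valid (P ∪ ｛ v ｝) ((f [ w ↦ fr ]) [ v ↦ f w ])
  relocate {P} {f} {v} {w} {fr} valid Pw fr-free w→fr v→fw = place moved fw-free fw-compatible
    where
    f₁ = f [ w ↦ fr ]
    others : Pred (Fin n) 0ℓ
    others u = P u × u ≢ w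
    regroup : ∀ {u} → P u → (others ∪ ｛ w ｝) u
    regroup {u} Pu with u Finₚ.≟ w
    ... | yes refl = inj₂ refl
    ... | no u≢w = inj₁ (Pu , u≢w)
    moved : Valid P f₁
    moved = restrict regroup
      (place (restrict proj₁ valid) (λ other → fr-free (proj₁ other)) (λ other → w→fr (proj₁ other)))
    fw-free : Free P f₁ (f w)
    fw-free {u} Pu same with u Finₚ.≟ w
    ... | yes refl = fr-free Pw (sym same)
    ... | no u≢w = u≢w (injective valid Pu Pw same)
    fw-compatible : Compatible P f₁ v (f w)
    fw-compatible {u} Pu v~u = subst (Separated (f w)) (sym (↦-other f fr u≢w)) (v→fw Pu v~u)
      where
      u≢w : u ≢ w
      u≢w refl = proj₁ (v→fw Pw v~u) refl

  placement⇒orthogonal : ∀ {f} → Valid U f → HasOrthPair G k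
  placement⇒orthogonal {f} valid =
      proj₁ ∘ f , proj₂ ∘ f
    , (λ u w u~w → proj₁ (separated valid _ _ u~w))
    , (λ u w u~w → proj₂ (separated valid _ _ u~w))
    , (λ u w same-row same-col → injective valid _ _ (cong₂ _,_ same-row same-col))

module Extension {n : ℕ} (G : Graph n) {k d : ℕ}
                 (room : n ≤ k * k) (sparse : (k + k) * maxDeg G < (k ∸ d) * (k ∸ d)) where
  open Grid G k

  module _ {P : Pred (Fin n) 0ℓ} (P? : Decidable P) {f : Fin n → Cell} (valid : Valid P f) where

    Occupied : Cell → Set
    Occupied c = ∃ λ u → P u × f u ≡ c

    occupied? : Decidable Occupied
    occupied? c = Finₚ.any? (λ u → P? u ×-dec (f u ≟ᶜ c))

    unoccupied⇒free : ∀ {c} → ¬ Occupied c → Free P f c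
    unoccupied⇒free unoccupied Pu same = unoccupied (_ , Pu , same)

    -- While some vertex is unplaced, fewer than n ≤ k² cells are occupied.
    freeCell : ∀ {v} → ¬ P v → ∃ λ c → ¬ Occupied c
    freeCell {v} ¬Pv = c , λ (u , Pu , fu≡c) →
      c∉ (subst (_∈ map f placed) fu≡c (∈-map⁺ f (∈-filter⁺ P? (∈-allFin u) Pu)))
      where
      placed = filter P? (allFin n)
      allCells = cartesianProduct (allFin k) (allFin k)
      fewer : length (map f placed) < length allCells
      fewer = begin-strict
        length (map f placed)                 ≡⟨ length-map f placed ⟩
        length placed                         <⟨ filter-notAll P? (allFin n) (lose (∈-allFin v) ¬Pv) ⟩
        length (allFin n)                     ≡⟨ length-allFin n ⟩
        n                                     ≤⟨ room ⟩
        k * k                                 ≡⟨ cong₂ _*_ (length-allFin k) (length-allFin k) ⟨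
        length (allFin k) * length (allFin k) ≡⟨ length-cartesianProduct (allFin k) (allFin k) ⟨
        length allCells                       ∎
        where open ≤-Reasoning
      outsider = longer⇒∃∉ _≟ᶜ_ (cartesianProduct⁺ (allFin⁺ k) (allFin⁺ k)) fewer
      c = proj₁ outsider
      c∉ = proj₂ (proj₂ outsider)

    -- The cells sharing a row or a column with fr, and the vertices adjacent to
    -- their occupants.  A vertex that is not blocked may move to fr.
    module Blocked (fr : Cell) where

      cross : List Cell
      cross = map (proj₁ fr ,_) (allFin k) ++ map (_, proj₂ fr) (allFin k)

      cross-length : length cross ≡ k + k
      cross-length = begin
        length cross
          ≡⟨ length-++ (map (proj₁ fr ,_) (allFin k)) ⟩
        length (map (proj₁ fr ,_) (allFin k)) + length (map (_, proj₂ fr) (allFin k))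
          ≡⟨ cong₂ _+_ (length-map _ (allFin k)) (length-map _ (allFin k)) ⟩
        length (allFin k) + length (allFin k)
          ≡⟨ cong₂ _+_ (length-allFin k) (length-allFin k) ⟩
        k + k ∎
        where open ≡-Reasoning

      occupantNbrs : Cell → List (Fin n)
      occupantNbrs c with occupied? c
      ... | yes (u , _) = nbrs G u
      ... | no _ = []

      blocked : List (Fin n)
      blocked = concatMap occupantNbrs cross

      blocked-length : length blocked ≤ (k + k) * maxDeg G
      blocked-length = begin
        length blocked               ≤⟨ length-concatMap≤ occupantNbrs occupant-degree cross ⟩
        length cross * maxDeg G      ≡⟨ cong (_* maxDeg G) cross-length ⟩
        (k + k) * maxDeg G           ∎
        where
        open ≤-Reasoning
        occupant-degree : ∀ c → length (occupantNbrs c) ≤ maxDeg G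
        occupant-degree c with occupied? c
        ... | yes (u , _) = nbrs-length G u
        ... | no _ = z≤n

      nbr-blocked : ∀ {u x} → P u → f u ∈ cross → T (adj G u x) → x ∈ blocked
      nbr-blocked {u} {x} Pu fu∈cross u~x = ∈-concat⁺′ x∈occupantNbrs (∈-map⁺ occupantNbrs fu∈cross)
        where
        x∈occupantNbrs : x ∈ occupantNbrs (f u)
        x∈occupantNbrs with occupied? (f u)
        ... | yes (u′ , Pu′ , same) =
          subst (λ y → x ∈ nbrs G y) (injective valid Pu Pu′ (sym same)) (∈-nbrs G u~x)
        ... | no unoccupied = ⊥-elim (unoccupied (u , Pu , refl))

      same-row⇒∈cross : ∀ {c} → proj₁ fr ≡ proj₁ c → c ∈ cross
      same-row⇒∈cross {_ , s} refl = ∈-++⁺ˡ (∈-map⁺ (proj₁ fr ,_) (∈-allFin s))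

      same-col⇒∈cross : ∀ {c} → proj₂ fr ≡ proj₂ c → c ∈ cross
      same-col⇒∈cross {r , _} refl = ∈-++⁺ʳ _ (∈-map⁺ (_, proj₂ fr) (∈-allFin r))

      unblocked⇒compatible : ∀ {w} → w ∉ blocked → Compatible P f w fr
      unblocked⇒compatible w∉ Pu w~u =
          (λ same-row → w∉ (nbr-blocked Pu (same-row⇒∈cross same-row) (adj-sym G w~u)))
        , (λ same-col → w∉ (nbr-blocked Pu (same-col⇒∈cross same-col) (adj-sym G w~u)))

    module Good (L : List (Fin n)) where

      good : List Cell
      good = cartesianProduct (outside (map (proj₁ ∘ f) L)) (outside (map (proj₂ ∘ f) L))

      good-unique : Unique good
      good-unique = cartesianProduct⁺ (outside-unique _) (outside-unique _)

      avoids : ∀ (π : Cell → Fin k) {a u} → a ∈ outside (map (π ∘ f) L) → u ∈ L → a ≢ π (f u)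
      avoids π a∈ u∈L refl = ∈-outside⁻ a∈ (∈-map⁺ (π ∘ f) u∈L)

      good-compatible : ∀ {v c} → (∀ {u} → P u → T (adj G v u) → u ∈ L) →
                        c ∈ good → Compatible P f v c
      good-compatible covers c∈good Pu v~u =
        let (row∈ , col∈) = ∈-cartesianProduct⁻ _ _ c∈good
        in avoids proj₁ row∈ (covers Pu v~u) , avoids proj₂ col∈ (covers Pu v~u)

      -- At most d vertices rule out at most d rows and d columns.
      good-length : length L ≤ d → (k ∸ d) * (k ∸ d) ≤ length good
      good-length short = begin
        (k ∸ d) * (k ∸ d)                       ≤⟨ *-mono-≤ (avoid proj₁) (avoid proj₂) ⟩
        length rows * length cols               ≡⟨ length-cartesianProduct rows cols ⟨
        length good                             ∎
        where
        open ≤-Reasoning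
        rows = outside (map (proj₁ ∘ f) L)
        cols = outside (map (proj₂ ∘ f) L)
        avoid : (π : Cell → Fin k) → k ∸ d ≤ length (outside (map (π ∘ f) L))
        avoid π = ≤-trans (∸-monoʳ-≤ k (≤-trans (≤-reflexive (length-map (π ∘ f) L)) short))
                          (outside-length (map (π ∘ f) L))

    -- Take a free cell fr and a good cell g outside the
    -- image of the blocked vertices (more good cells than blocked vertices).
    -- Either g is free and v goes there, or its occupant w is not blocked,
    -- moves to fr, and v takes g.
    extend : ∀ {v} → ¬ P v → (L : List (Fin n)) → length L ≤ d →
             (∀ {u} → P u → T (adj G v u) → u ∈ L) → ∃ λ f′ → Valid (P ∪ ｛ v ｝) f′
    extend {v} ¬Pv L short covers = settle (occupied? g)
      where
      free-choice = freeCell ¬Pv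
      fr = proj₁ free-choice
      open Blocked fr
      open Good L
      more-good : length (map f blocked) < length good
      more-good = begin-strict
        length (map f blocked) ≡⟨ length-map f blocked ⟩
        length blocked         ≤⟨ blocked-length ⟩
        (k + k) * maxDeg G     <⟨ sparse ⟩
        (k ∸ d) * (k ∸ d)      ≤⟨ good-length short ⟩
        length good            ∎
        where open ≤-Reasoning
      choice = longer⇒∃∉ _≟ᶜ_ good-unique more-good
      g = proj₁ choice
      g-compatible : Compatible P f v g
      g-compatible = good-compatible covers (proj₁ (proj₂ choice))
      settle : Dec (Occupied g) → ∃ λ f′ → Valid (P ∪ ｛ v ｝) f′
      settle (no unoccupied) = _ , place valid (unoccupied⇒free unoccupied) g-compatible
      settle (yes (w , Pw , fw≡g)) =
        _ , relocate valid Pw (unoccupied⇒free (proj₂ free-choice)) (unblocked⇒compatible w∉)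
                     (subst (Compatible P f v) (sym fw≡g) g-compatible)
        where
        w∉ : w ∉ blocked
        w∉ w∈ = proj₂ (proj₂ choice) (subst (_∈ map f blocked) fw≡g (∈-map⁺ f w∈))

  module Degeneracy (origin : Cell) (pos : Fin n → Fin n) (pos-injective : Injective _≡_ _≡_ pos)
                    (few : ∀ v → earlierNbrs G pos v ≤ d) where

    Before : ℕ → Pred (Fin n) 0ℓ
    Before t u = toℕ (pos u) < t

    earlier : Fin n → List (Fin n)
    earlier v = filterᵇ (λ u → adj G v u ∧ (toℕ (pos u) <ᵇ toℕ (pos v))) (allFin n)

    ∈-earlier : ∀ {u v} → toℕ (pos u) < toℕ (pos v) → T (adj G v u) → u ∈ earlier v
    ∈-earlier {u} {v} u<v v~u =
      ∈-filter⁺ (λ u → T? (adj G v u ∧ (toℕ (pos u) <ᵇ toℕ (pos v)))) (∈-allFin u)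
                (Equivalence.from T-∧ (v~u , <⇒<ᵇ u<v))

    -- At step t + 1 the vertex in position t (if any) is added by extend,
    -- its earlier neighbours being the only neighbours already placed.
    placeBefore : ∀ t → ∃ λ f → Valid (Before t) f
    placeBefore zero = (λ _ → origin) , record { injective = λ () ; separated = λ () }
    placeBefore (suc t) with placeBefore t | Finₚ.any? (λ v → toℕ (pos v) ≟ t)
    ... | f , valid | no nobody = f , restrict still-before valid
      where
      still-before : ∀ {u} → Before (suc t) u → Before t u
      still-before {u} u<1+t with m<1+n⇒m<n∨m≡n u<1+t
      ... | inj₁ u<t = u<t
      ... | inj₂ u≡t = ⊥-elim (nobody (u , u≡t))
    ... | f , valid | yes (v , v≡t) = proj₁ extended , restrict before-or-v (proj₂ extended)
      where
      extended = extend (λ u → toℕ (pos u) <? t) valid (λ v<t → <-irrefl v≡t v<t) (earlier v) (few v)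
                        (λ u<t v~u → ∈-earlier (subst (_ <_) (sym v≡t) u<t) v~u)
      before-or-v : ∀ {u} → Before (suc t) u → (Before t ∪ ｛ v ｝) u
      before-or-v {u} u<1+t with m<1+n⇒m<n∨m≡n u<1+t
      ... | inj₁ u<t = inj₁ u<t
      ... | inj₂ u≡t = inj₂ (pos-injective (Finₚ.toℕ-injective (trans v≡t (sym u≡t))))

    placeAll : ∃ λ f → Valid U f
    placeAll = proj₁ everyone , restrict (λ {u} _ → Finₚ.toℕ<n (pos u)) (proj₂ everyone)
      where everyone = placeBefore n

orthogonal⇒n≤c² : ∀ {n c} (G : Graph n) → HasOrthPair G c → n ≤ c * c
orthogonal⇒n≤c² G (c₁ , c₂ , _ , _ , orthogonal) = Finₚ.injective⇒≤ λ {u} {w} same →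
  let (same₁ , same₂) = Finₚ.combine-injective (c₁ u) (c₂ u) (c₁ w) (c₂ w) same
  in orthogonal u w same₁ same₂

theorem5 : (n d : ℕ) (G : Graph n) → Degenerate d G → DegreeBound G d →
    (k : ℕ) → IsCeilSqrt n k → OChiIs G k
theorem5 n d G (pos , pos-injective , few) bound k (n≤k² , least) = upper , lower
  where
  2Δ+2d+1<k : 2 * maxDeg G + 2 * d + 1 < k
  2Δ+2d+1<k = square-<-bound bound n≤k²
  corner : Fin k
  corner = fromℕ< (≤-<-trans z≤n 2Δ+2d+1<k)
  open Extension G {k} {d} n≤k² (degree-bound⇒sparse k d (maxDeg G) 2Δ+2d+1<k)
  open Degeneracy (corner , corner) pos pos-injective few
  upper : HasOrthPair G k
  upper = Grid.placement⇒orthogonal G k (proj₂ placeAll)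
  lower : ∀ c → HasOrthPair G c → k ≤ c
  lower c pair = least c (orthogonal⇒n≤c² G pair)
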